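{- Let $n\ge 1$, $q=2^n$, and let $\phi,\chi$ be quadratic forms over $\mathbb{F}_q$ in variables $x,y,z$ such that the pencil $\{\alpha\phi+\beta\chi : (\alpha:\beta)\in\mathrm{PG}(1,q)\}$ is a trivially intersecting pencil of non-singular conic translation ovals in $\mathrm{PG}(2,q)$. For each member $\alpha\phi+\beta\chi$ of the pencil let $S_{(\alpha:\beta)}=\{(x,y)\in\mathbb{F}_q^2 : \alpha\phi(x,y,1)+\beta\chi(x,y,1)=0\}$. Then the sets $S_{(\alpha:\beta)}$ form a spread of $\mathbb{F}_q^2\cong\mathbb{F}_2^{2n}$, the translation plane constructed from this spread is Desarguesian, and it is orthogoval to the translation plane constructed from the line spread.
   Context: Points of $\mathrm{PG}(2,q)$ are written $(x:y:z)$; the affine plane $\mathrm{AG}(2,q)$ is identified with the points $(x:y:1)$, i.e. with $\mathbb{F}_q^2$. An oval in $\mathrm{PG}(2,q)$ is a set of $q+1$ points no three collinear. For $q=2^n$, an oval $\mathcal{O}$ is a translation oval if $(x_0+x_1:y_0+y_1:1)\in\mathcal{O}$ whenever $(x_0:y_0:1),(x_1:y_1:1)\in\mathcal{O}$. Two translation ovals are trivially intersecting if they intersect only in $(0:0:1)$; a pencil of translation ovals is trivially intersecting if any two distinct members are. A spread of $\mathbb{F}_2^{2n}$ is a set of $n$-dimensional $\mathbb{F}_2$-subspaces pairwise intersecting only in $0$ (and covering the space); the translation plane constructed from a spread has point set $\mathbb{F}_2^{2n}$ and as lines all cosets of the spread members. The line spread is the set of $1$-dimensional $\mathbb{F}_q$-subspaces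 of $\mathbb{F}_q^2$; its translation plane is the Desarguesian $\mathrm{AG}(2,q)$. Two affine planes of the same order on the same point set are orthogoval if every line of one meets every line of the other in at most two points. -}

module Defs where

open import Level using (Level; 0ℓ)
open import Data.Nat using (ℕ; suc; _^_)
open import Data.Fin using (Fin)
open import Data.Product using (Σ; Σ-syntax; _×_; _,_; ∃; ∃-syntax)
open import Data.Sum using (_⊎_)
open import Relation.Nullary using (¬_)
open import Relation.Binary.Definitions using (DecidableEquality)
open import Relation.Binary.PropositionalEquality using (_≡_; _≢_)
open import Algebra.Structures using (IsCommutativeRing)
open import Function.Bundles using (_↔_; _⇔_; Inverse)

-- This determines F_{2^n} up to isomorphism.

record GF2^ (n : ℕ) : Set₁ where
  infixl 6 _+_
  infixl 7 _*_
  field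
    Carrier : Set
    _+_ _*_ : Carrier → Carrier → Carrier
    -_ : Carrier → Carrier
    0# 1# : Carrier
    isCommutativeRing : IsCommutativeRing _≡_ _+_ _*_ -_ 0# 1#
    0≢1 : 0# ≢ 1#
    inverse : ∀ x → x ≢ 0# → Σ[ y ∈ Carrier ] x * y ≡ 1#
    char2 : 1# + 1# ≡ 0#
    _≟_ : DecidableEquality Carrier
    size : Carrier ↔ Fin (2 ^ n)

HasSize : {A : Set} → (A → Set) → ℕ → Set
HasSize {A} P m = Σ A P ↔ Fin m

module Geometry {n : ℕ} (F : GF2^ n) where
  open GF2^ F

  q : ℕ
  q = 2 ^ n

  data PG1 : Set where
    fin : Carrier → PG1
    inf : PG1

  rep1 : PG1 → Carrier × Carrier
  rep1 (fin a) = a , 1#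
  rep1 inf     = 1# , 0#

  data PG2 : Set where
    aff : Carrier → Carrier → PG2
    ∞₁  : Carrier → PG2
    ∞₂  : PG2

  record Triple : Set where
    constructor ⟨_,_,_⟩
    field
      X Y Z : Carrier

  rep : PG2 → Triple
  rep (aff x y) = ⟨ x , y , 1# ⟩
  rep (∞₁ x)    = ⟨ x , 1# , 0# ⟩
  rep ∞₂        = ⟨ 1# , 0# , 0# ⟩

  record QForm : Set where
    field
      a b c d e f : Carrier

  eval : QForm → Carrier → Carrier → Carrier → Carrier
  eval Q x y z = a * (x * x) + b * (y * y) + c * (z * z)
               + d * (x * y) + e * (x * z) + f * (y * z)
    where open QForm Q

  lin : Carrier → QForm → Carrier → QForm → QForm
  lin α Q β R = record
    { a = α * QForm.a Q + β * QForm.a R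
    ; b = α * QForm.b Q + β * QForm.b R
    ; c = α * QForm.c Q + β * QForm.c R
    ; d = α * QForm.d Q + β * QForm.d R
    ; e = α * QForm.e Q + β * QForm.e R
    ; f = α * QForm.f Q + β * QForm.f R
    }

  -- Discriminant of a ternary quadratic form in characteristic 2
  -- (Hirschfeld: Δ = 4abc + fgh − af² − bg² − ch², reduced mod 2).
  -- The conic Q = 0 is non-singular iff Δ ≠ 0.
  Δ : QForm → Carrier
  Δ Q = a * (f * f) + b * (e * e) + c * (d * d) + d * (e * f)
    where open QForm Q

  NonSingular : QForm → Set
  NonSingular Q = Δ Q ≢ 0#

  member : QForm → QForm → PG1 → QForm
  member φ χ t with rep1 t
  ... | α , β = lin α φ β χ

  ConicPts : QForm → PG2 → Set
  ConicPts Q p = eval Q X Y Z ≡ 0#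
    where open Triple (rep p)

  det : Triple → Triple → Triple → Carrier
  det ⟨ x₁ , y₁ , z₁ ⟩ ⟨ x₂ , y₂ , z₂ ⟩ ⟨ x₃ , y₃ , z₃ ⟩ =
      x₁ * (y₂ * z₃ + - (y₃ * z₂))
    + - (y₁ * (x₂ * z₃ + - (x₃ * z₂)))
    + z₁ * (x₂ * y₃ + - (x₃ * y₂))

  Collinear : PG2 → PG2 → PG2 → Set
  Collinear p p′ p″ = det (rep p) (rep p′) (rep p″) ≡ 0#

  IsOval : (PG2 → Set) → Set
  IsOval O = HasSize O (suc q)
           × (∀ p p′ p″ → O p → O p′ → O p″ →
                p ≢ p′ → p′ ≢ p″ → p ≢ p″ → ¬ Collinear p p′ p″)

  IsTranslationOval : (PG2 → Set) → Set
  IsTranslationOval O = IsOval O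
    × (∀ x₀ y₀ x₁ y₁ → O (aff x₀ y₀) → O (aff x₁ y₁) → O (aff (x₀ + x₁) (y₀ + y₁)))

  TriviallyIntersecting : (PG2 → Set) → (PG2 → Set) → Set
  TriviallyIntersecting O O′ = ∀ p → O p → O′ p → p ≡ aff 0# 0#

  TIPencilOfConicTranslationOvals : QForm → QForm → Set
  TIPencilOfConicTranslationOvals φ χ =
      (∀ t → NonSingular (member φ χ t) × IsTranslationOval (ConicPts (member φ χ t)))
    × (∀ s t → s ≢ t → TriviallyIntersecting (ConicPts (member φ χ s)) (ConicPts (member φ χ t)))

  -- The vector space F_q² (as an F_2-space: only its addition matters)

  V : Set
  V = Carrier × Carrier

  _⊕_ : V → V → V
  (x , y) ⊕ (x′ , y′) = (x + x′) , (y + y′)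

  _⊖_ : V → V → V
  (x , y) ⊖ (x′ , y′) = (x + - x′) , (y + - y′)

  𝟘 : V
  𝟘 = 0# , 0#

  S : QForm → QForm → PG1 → V → Set
  S φ χ t (x , y) = let (α , β) = rep1 t in
    α * eval φ x y 1# + β * eval χ x y 1# ≡ 0#

  -- An n-dimensional F_2-subspace of F_q² ≅ F_2^{2n}: contains 0,
  -- closed under addition (the only F_2-scalars are 0 and 1), and
  -- has 2^n = q elements.
  IsNDimF2Subspace : (V → Set) → Set
  IsNDimF2Subspace W = W 𝟘 × (∀ u v → W u → W v → W (u ⊕ v)) × HasSize W q

  IsSpread : {I : Set} → (I → V → Set) → Set
  IsSpread {I} W =
      (∀ i → IsNDimF2Subspace (W i))
    × (∀ i j → i ≢ j → ∀ v → W i v → W j v → v ≡ 𝟘)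
    × (∀ v → ∃[ i ] W i v)

  IsLine : {I : Set} → (I → V → Set) → (V → Set) → Set
  IsLine {I} W L = Σ[ i ∈ I ] Σ[ v ∈ V ] (∀ w → L w ⇔ W i (w ⊖ v))

  LineSpread : PG1 → V → Set
  LineSpread t (x , y) = let (α , β) = rep1 t in
    ∃[ k ] (x ≡ k * α × y ≡ k * β)

  IsomorphicPlanes : {I J : Set} → (I → V → Set) → (J → V → Set) → Set₁
  IsomorphicPlanes W W′ = Σ[ f ∈ V ↔ V ]
      ((∀ L → IsLine W L → IsLine W′ (λ w → L (Inverse.from f w)))
     × (∀ L → IsLine W′ L → IsLine W (λ w → L (Inverse.to f w))))

  IsDesarguesian : {I : Set} → (I → V → Set) → Set₁
  IsDesarguesian W = IsomorphicPlanes W LineSpread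

  Orthogoval : {I J : Set} → (I → V → Set) → (J → V → Set) → Set₁
  Orthogoval W W′ = ∀ L M → IsLine W L → IsLine W′ M →
    ∀ u v w → L u → L v → L w → M u → M v → M w →
    u ≡ v ⊎ v ≡ w ⊎ u ≡ w

-- The affine part of each member Q of the pencil is closed under addition, so it contains
-- the origin (c = 0), and then in characteristic 2, at z = 1,
--   Q(u + v) = Q(u) + Q(v) + d (x y′ + x′ y).
-- If d ≠ 0, any two affine points of the oval are collinear with the origin, so the oval has
-- at most four points; when q = 2 such a member has no nonzero affine point at all, and
-- covering the three nonzero vectors by members with d = 0 forces d_φ = d_χ = 0.
-- Hence Ψ(v) = (φ(v,1), χ(v,1)) is additive, injective because the pencil is trivially
-- intersecting, hence a bijection of F_q², and S_(α:β) = Ψ⁻¹{w : α w₁ + β w₂ = 0}.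
-- These kernels are the line spread relabelled, so the S's form a spread whose plane Ψ maps
-- onto AG(2,q).  A line of that plane is a translate of the affine part of an oval, so it
-- meets every line of AG(2,q) in at most two points.

module Submission where

open import Level using (0ℓ)
open import Data.Nat as ℕ using (ℕ; suc; z≤n; s≤s; _≤_)
import Data.Nat.Properties as ℕP
open import Data.Nat.Properties using (+-suc; +-mono-≤; <⇒≱; module ≤-Reasoning)
open import Data.Empty using (⊥; ⊥-elim)
open import Data.Sum using (_⊎_; inj₁; inj₂)
open import Data.Product using (Σ; Σ-syntax; _×_; _,_; proj₁; proj₂; ∃; ∃-syntax)
open import Data.Product.Properties using (Σ-≡,≡→≡; ≡-dec)
open import Data.Product.Function.Dependent.Propositional using (Σ-↔)
open import Data.Product.Function.NonDependent.Propositional using (_×-↔_)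
open import Data.Fin as Fin using (Fin)
import Data.Fin.Properties as FinP
open import Data.Fin.Properties using (*↔×)
open import Data.List as List using (List; []; _∷_; length; filter)
import Data.List.Properties as List
open import Data.List.Relation.Unary.All as All using (All; []; _∷_)
import Data.List.Relation.Unary.All.Properties as All
open import Data.List.Relation.Unary.AllPairs using ([]; _∷_)
open import Data.List.Relation.Unary.Unique.Propositional using (Unique)
import Data.List.Relation.Unary.Unique.Propositional.Properties as Unique
import Data.Vec as Vec
import Data.Vec.Relation.Unary.All.Properties as VAll
open import Data.Vec.Relation.Unary.AllPairs using ([]; _∷_)
import Data.Vec.Relation.Unary.Unique.Propositional as Vec
import Data.Vec.Relation.Unary.Unique.Propositional.Properties as VUnique
open import Algebra.Bundles using (CommutativeRing)
open import Axiom.UniquenessOfIdentityProofs using (module Decidable⇒UIP)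
open import Function.Base using (_∘_)
open import Function.Bundles using (Inverse; _↔_; mk↔ₛ′; Equivalence; _⇔_; mk⇔)
open import Function.Consequences.Propositional using (inverseʳ⇒injective)
open import Function.Construct.Composition using (_↔-∘_; _⇔-∘_)
open import Function.Construct.Identity using (↔-id)
open import Function.Construct.Symmetry using (⇔-sym; ↔-sym)
open import Relation.Binary.Definitions using (DecidableEquality)
open import Relation.Binary.PropositionalEquality
open import Relation.Nullary using (¬_; yes; no)
open import Relation.Nullary.Decidable using (decidable-stable)
open import Relation.Unary using (Decidable; _∩_; ∁)
open import Relation.Unary.Properties using (∁?)

open import Defs

NoThreeDistinct : {A : Set} → (A → Set) → Set
NoThreeDistinct {A} P =
  ∀ {x y z : A} → x ≢ y → y ≢ z → x ≢ z → P x → P y → P z → ⊥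

module _ {A : Set} where

  unique-length≤2 : ∀ {P : A → Set} → NoThreeDistinct P →
    ∀ {xs} → Unique xs → All P xs → length xs ≤ 2
  unique-length≤2 _ {[]} _ _ = z≤n
  unique-length≤2 _ {_ ∷ []} _ _ = s≤s z≤n
  unique-length≤2 _ {_ ∷ _ ∷ []} _ _ = s≤s (s≤s z≤n)
  unique-length≤2 no3 {_ ∷ _ ∷ _ ∷ _} ((x≢y ∷ x≢z ∷ _) ∷ (y≢z ∷ _) ∷ _) (px ∷ py ∷ pz ∷ _) =
    ⊥-elim (no3 x≢y y≢z x≢z px py pz)

  length-filter+filter-∁ : ∀ {P : A → Set} (P? : Decidable P) xs →
    length (filter P? xs) ℕ.+ length (filter (∁? P?) xs) ≡ length xs
  length-filter+filter-∁ P? [] = refl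
  length-filter+filter-∁ P? (x ∷ xs) with P? x
  ... | yes _ = cong suc (length-filter+filter-∁ P? xs)
  ... | no _ = trans (+-suc _ _) (cong suc (length-filter+filter-∁ P? xs))

  unique-length≤4 : ∀ {P Q : A → Set} (P? : Decidable P) →
    NoThreeDistinct (Q ∩ P) → NoThreeDistinct (Q ∩ ∁ P) →
    ∀ {xs} → Unique xs → All Q xs → length xs ≤ 4
  unique-length≤4 {Q = Q} P? noP no∁P {xs} xs! Qxs = begin
    length xs                                              ≡⟨ sym (length-filter+filter-∁ P? xs) ⟩
    length (filter P? xs) ℕ.+ length (filter (∁? P?) xs)   ≤⟨ +-mono-≤ (part P? noP) (part (∁? P?) no∁P) ⟩
    4                                                      ∎
    where
    open ≤-Reasoning
    part : ∀ {R} (R? : Decidable R) → NoThreeDistinct (Q ∩ R) → length (filter R? xs) ≤ 2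
    part R? no3 = unique-length≤2 no3 (Unique.filter⁺ R? xs!)
                    (All.zip (All.filter⁺ R? Qxs , All.all-filter R? xs))

  fromList-unique : ∀ {xs : List A} → Unique xs → Vec.Unique (Vec.fromList xs)
  fromList-unique [] = []
  fromList-unique (x∉xs ∷ xs!) = VAll.fromList⁺ x∉xs ∷ fromList-unique xs!

  some-element : ∀ {P Q : A → Set} (P? : Decidable P) → NoThreeDistinct (Q ∩ ∁ P) →
    ∀ {xs} → Unique xs → All Q xs → 3 ≤ length xs → ∃ (Q ∩ P)
  some-element {P} {Q} P? no∁P {xs} xs! Qxs 3≤len
    with filter P? xs | All.filter⁺ P? Qxs | All.all-filter P? xs | length-filter+filter-∁ P? xs
  ... | y ∷ _ | Qy ∷ _ | Py ∷ _ | _ = y , Qy , Py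
  ... | [] | _ | _ | len-∁ = ⊥-elim (<⇒≱ 3≤len (begin
    length xs                     ≡⟨ sym len-∁ ⟩
    length (filter (∁? P?) xs)    ≤⟨ unique-length≤2 no∁P (Unique.filter⁺ (∁? P?) xs!)
                                       (All.zip (All.filter⁺ (∁? P?) Qxs , All.all-filter (∁? P?) xs)) ⟩
    2                             ∎))
    where open ≤-Reasoning

  module _ {P : A → Set} {m : ℕ} (P-size : HasSize P m) where
    open Inverse P-size

    unique-length≤size : ∀ {xs} → Unique xs → All P xs → length xs ≤ m
    unique-length≤size {xs} xs! Pxs = FinP.injective⇒≤ index-injective
      where
      index : Fin (length xs) → Fin m
      index i = to (Vec.lookup (Vec.fromList xs) i , VAll.lookup⁺ (VAll.fromList⁺ Pxs) i)
      index-injective : ∀ {i j} → index i ≡ index j → i ≡ j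
      index-injective e = VUnique.lookup-injective (fromList-unique xs!) _ _
        (cong proj₁ (inverseʳ⇒injective to inverseʳ e))

    enumeration : (∀ {x} (p p′ : P x) → p ≡ p′) →
      Σ[ xs ∈ List A ] Unique xs × All P xs × length xs ≡ m
    enumeration P-irrelevant =
      List.tabulate element , Unique.tabulate⁺ element-injective ,
      All.tabulate⁺ (λ i → proj₂ (from i)) , List.length-tabulate element
      where
      element : Fin m → A
      element i = proj₁ (from i)
      element-injective : ∀ {i j} → element i ≡ element j → i ≡ j
      element-injective {i} {j} e = begin
        i                  ≡⟨ sym (strictlyInverseˡ i) ⟩
        to (from i)        ≡⟨ cong to (Σ-≡,≡→≡ (e , P-irrelevant _ _)) ⟩
        to (from j)        ≡⟨ strictlyInverseˡ j ⟩
        j                  ∎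
        where open ≡-Reasoning

≡⇒⇔ : ∀ {A : Set} (P : A → Set) {x y} → x ≡ y → P x ⇔ P y
≡⇒⇔ P refl = mk⇔ (λ px → px) (λ px → px)

fin-injective⇒surjective : ∀ {m} (h : Fin m → Fin m) → (∀ {x y} → h x ≡ h y → x ≡ y) →
  ∀ y → ∃[ x ] h x ≡ y
fin-injective⇒surjective {suc m} h h-injective y with FinP.any? (λ x → h x Fin.≟ y)
... | yes hit = hit
... | no miss = ⊥-elim (ℕP.<-irrefl refl (FinP.injective⇒≤ {f = squeeze} squeeze-injective))
  where
  squeeze : Fin (suc m) → Fin m
  squeeze x = Fin.punchOut {i = y} {j = h x} (λ y≡hx → miss (x , sym y≡hx))
  squeeze-injective : ∀ {a b} → squeeze a ≡ squeeze b → a ≡ b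
  squeeze-injective e = h-injective (FinP.punchOut-injective {i = y} _ _ e)

injective-endo↔ : ∀ {A : Set} {m} → A ↔ Fin m → (f : A → A) →
  (∀ {x y} → f x ≡ f y → x ≡ y) → A ↔ A
injective-endo↔ {A} A↔Fin f f-injective = mk↔ₛ′ f g f∘g g∘f
  where
  open Inverse A↔Fin
  h : Fin _ → Fin _
  h = to ∘ f ∘ from
  h-injective : ∀ {x y} → h x ≡ h y → x ≡ y
  h-injective {x} {y} e = begin
    x                ≡⟨ sym (strictlyInverseˡ x) ⟩
    to (from x)      ≡⟨ cong to (f-injective (inverseʳ⇒injective to inverseʳ e)) ⟩
    to (from y)      ≡⟨ strictlyInverseˡ y ⟩
    y                ∎
    where open ≡-Reasoning
  g : A → A
  g a = from (proj₁ (fin-injective⇒surjective h h-injective (to a)))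
  f∘g : ∀ a → f (g a) ≡ a
  f∘g a = inverseʳ⇒injective to inverseʳ (proj₂ (fin-injective⇒surjective h h-injective (to a)))
  g∘f : ∀ a → g (f a) ≡ a
  g∘f a = f-injective (f∘g (f a))

module Char2Field {n : ℕ} (F : GF2^ n) where
  open GF2^ F

  commutativeRing : CommutativeRing 0ℓ 0ℓ
  commutativeRing = record { isCommutativeRing = isCommutativeRing }

  open import Algebra.Solver.Ring.NaturalCoefficients.Default
    (CommutativeRing.commutativeSemiring commutativeRing) public
  open CommutativeRing commutativeRing public
    using ( +-assoc; +-identityˡ; +-identityʳ; -‿inverseˡ
          ; *-comm; *-identityˡ; *-identityʳ; zeroˡ; zeroʳ; distribˡ; distribʳ)
  open ≡-Reasoning

  x+x≡0 : ∀ x → x + x ≡ 0#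
  x+x≡0 x = begin
    x + x              ≡⟨ cong₂ _+_ (sym (*-identityʳ x)) (sym (*-identityʳ x)) ⟩
    x * 1# + x * 1#    ≡⟨ sym (distribˡ x 1# 1#) ⟩
    x * (1# + 1#)      ≡⟨ cong (x *_) char2 ⟩
    x * 0#             ≡⟨ zeroʳ x ⟩
    0#                 ∎

  x+y≡0⇒x≡y : ∀ {x y} → x + y ≡ 0# → x ≡ y
  x+y≡0⇒x≡y {x} {y} x+y≡0 = begin
    x                  ≡⟨ sym (+-identityʳ x) ⟩
    x + 0#             ≡⟨ cong (x +_) (sym (x+x≡0 y)) ⟩
    x + (y + y)        ≡⟨ sym (+-assoc x y y) ⟩
    (x + y) + y        ≡⟨ cong (_+ y) x+y≡0 ⟩
    0# + y             ≡⟨ +-identityˡ y ⟩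
    y                  ∎

  -x≡x : ∀ x → - x ≡ x
  -x≡x x = x+y≡0⇒x≡y (-‿inverseˡ x)

  1*x+0*y≡x : ∀ x y → 1# * x + 0# * y ≡ x
  1*x+0*y≡x = solve 2 (λ x y → con 1 :* x :+ con 0 :* y := x) refl

  0*x+1*y≡y : ∀ x y → 0# * x + 1# * y ≡ y
  0*x+1*y≡y = solve 2 (λ x y → con 0 :* x :+ con 1 :* y := y) refl

  inv : (x : Carrier) → x ≢ 0# → Carrier
  inv x x≢0 = proj₁ (inverse x x≢0)

  1≢0 : 1# ≢ 0#
  1≢0 1≡0 = 0≢1 (sym 1≡0)

  *-inverseʳ : ∀ x (x≢0 : x ≢ 0#) → x * inv x x≢0 ≡ 1#
  *-inverseʳ x x≢0 = proj₂ (inverse x x≢0)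

  x≢0∧x*y≡0⇒y≡0 : ∀ {x y} → x ≢ 0# → x * y ≡ 0# → y ≡ 0#
  x≢0∧x*y≡0⇒y≡0 {x} {y} x≢0 x*y≡0 = begin
    y                      ≡⟨ sym (*-identityˡ y) ⟩
    1# * y                 ≡⟨ cong (_* y) (sym (*-inverseʳ x x≢0)) ⟩
    (x * inv x x≢0) * y    ≡⟨ reassociate x (inv x x≢0) y ⟩
    inv x x≢0 * (x * y)    ≡⟨ cong (inv x x≢0 *_) x*y≡0 ⟩
    inv x x≢0 * 0#         ≡⟨ zeroʳ _ ⟩
    0#                     ∎
    where
    reassociate : ∀ a b c → (a * b) * c ≡ b * (a * c)
    reassociate = solve 3 (λ a b c → (a :* b) :* c := b :* (a :* c)) refl

  quadratic-other-root : ∀ {a b d t} (a≢0 : a ≢ 0#) → a * (t * t) + d * t + b ≡ 0# →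
    let δ = d * inv a a≢0 in a * ((t + δ) * (t + δ)) + d * (t + δ) + b ≡ 0#
  quadratic-other-root {a} {b} {d} {t} a≢0 root = begin
    a * ((t + δ) * (t + δ)) + d * (t + δ) + b
      ≡⟨ solve 5 (λ a b d t δ →
           a :* ((t :+ δ) :* (t :+ δ)) :+ d :* (t :+ δ) :+ b
           := (a :* (t :* t) :+ d :* t :+ b) :+ δ :* (a :* δ :+ d) :+ (a :* (t :* δ) :+ a :* (t :* δ))) refl a b d t δ ⟩
    (a * (t * t) + d * t + b) + δ * (a * δ + d) + (a * (t * δ) + a * (t * δ))
      ≡⟨ cong₂ (λ r e → r + δ * (a * δ + d) + e) root (x+x≡0 _) ⟩
    0# + δ * (a * δ + d) + 0#
      ≡⟨ cong (λ s → 0# + δ * (s + d) + 0#) aδ≡d ⟩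
    0# + δ * (d + d) + 0#
      ≡⟨ cong (λ e → 0# + δ * e + 0#) (x+x≡0 d) ⟩
    0# + δ * 0# + 0#
      ≡⟨ solve 1 (λ δ → con 0 :+ δ :* con 0 :+ con 0 := con 0) refl δ ⟩
    0#  ∎
    where
    a⁻¹ = inv a a≢0
    δ = d * a⁻¹
    aδ≡d : a * δ ≡ d
    aδ≡d = begin
      a * (d * a⁻¹)    ≡⟨ solve 3 (λ a d a⁻¹ → a :* (d :* a⁻¹) := d :* (a :* a⁻¹)) refl a d a⁻¹ ⟩
      d * (a * a⁻¹)    ≡⟨ cong (d *_) (*-inverseʳ a a≢0) ⟩
      d * 1#           ≡⟨ *-identityʳ d ⟩
      d                ∎

module PlaneGeometry {n : ℕ} (F : GF2^ n) where
  open GF2^ F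
  open Char2Field F
  open Geometry F
  open ≡-Reasoning

  _·_ : Carrier → V → V
  k · (x , y) = k * x , k * y

  cross : V → V → Carrier
  cross (x , y) (x′ , y′) = x * y′ + x′ * y

  _≟V_ : DecidableEquality V
  _≟V_ = ≡-dec _≟_ _≟_

  differ-in-x : ∀ {x y x′ y′ : Carrier} → x ≢ x′ → _≢_ {A = V} (x , y) (x′ , y′)
  differ-in-x x≢x′ refl = x≢x′ refl

  differ-in-y : ∀ {x y x′ y′ : Carrier} → y ≢ y′ → _≢_ {A = V} (x , y) (x′ , y′)
  differ-in-y y≢y′ refl = y≢y′ refl

  ⊕-identityˡ : ∀ u → 𝟘 ⊕ u ≡ u
  ⊕-identityˡ (x , y) = cong₂ _,_ (+-identityˡ x) (+-identityˡ y)

  ⊕-self : ∀ u → u ⊕ u ≡ 𝟘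
  ⊕-self (x , y) = cong₂ _,_ (x+x≡0 x) (x+x≡0 y)

  ⊖≡⊕ : ∀ u v → u ⊖ v ≡ u ⊕ v
  ⊖≡⊕ (x , y) (x′ , y′) = cong₂ _,_ (cong (x +_) (-x≡x x′)) (cong (y +_) (-x≡x y′))

  ⊕≡𝟘⇒≡ : ∀ {u v} → u ⊕ v ≡ 𝟘 → u ≡ v
  ⊕≡𝟘⇒≡ e = cong₂ _,_ (x+y≡0⇒x≡y (cong proj₁ e)) (x+y≡0⇒x≡y (cong proj₂ e))

  ⊖-⊕-⊖ : ∀ u v p → (u ⊖ p) ⊕ (v ⊖ p) ≡ u ⊕ v
  ⊖-⊕-⊖ u@(x , y) v@(x′ , y′) p@(s , t) = begin
    (u ⊖ p) ⊕ (v ⊖ p)     ≡⟨ cong₂ _⊕_ (⊖≡⊕ u p) (⊖≡⊕ v p) ⟩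
    (u ⊕ p) ⊕ (v ⊕ p)     ≡⟨ cong₂ _,_ (cancel x x′ s) (cancel y y′ t) ⟩
    u ⊕ v                 ∎
    where
    cancel : ∀ a b c → (a + c) + (b + c) ≡ a + b
    cancel a b c = begin
      (a + c) + (b + c)     ≡⟨ solve 3 (λ a b c → (a :+ c) :+ (b :+ c) := (a :+ b) :+ (c :+ c)) refl a b c ⟩
      (a + b) + (c + c)     ≡⟨ cong ((a + b) +_) (x+x≡0 c) ⟩
      (a + b) + 0#          ≡⟨ +-identityʳ (a + b) ⟩
      a + b                 ∎

  ⊖-cancelʳ : ∀ {u v} p → u ⊖ p ≡ v ⊖ p → u ≡ v
  ⊖-cancelʳ {u} {v} p e = ⊕≡𝟘⇒≡ (begin
    u ⊕ v                 ≡⟨ sym (⊖-⊕-⊖ u v p) ⟩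
    (u ⊖ p) ⊕ (v ⊖ p)     ≡⟨ cong (_⊕ (v ⊖ p)) e ⟩
    (v ⊖ p) ⊕ (v ⊖ p)     ≡⟨ ⊕-self (v ⊖ p) ⟩
    𝟘                     ∎)

  ·-distribʳ : ∀ k k′ w → (k · w) ⊕ (k′ · w) ≡ (k + k′) · w
  ·-distribʳ k k′ (x , y) = cong₂ _,_ (sym (distribʳ x k k′)) (sym (distribʳ y k k′))

  cross-· : ∀ k k′ w → cross (k · w) (k′ · w) ≡ 0#
  cross-· k k′ (x , y) = begin
    (k * x) * (k′ * y) + (k′ * x) * (k * y)
      ≡⟨ solve 4 (λ k k′ x y → (k :* x) :* (k′ :* y) :+ (k′ :* x) :* (k :* y)
                               := (k :* k′ :* x :* y) :+ (k :* k′ :* x :* y)) refl k k′ x y ⟩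
    k * k′ * x * y + k * k′ * x * y           ≡⟨ x+x≡0 _ ⟩
    0#                                        ∎

  affine : V → PG2
  affine (x , y) = aff x y

  affine-injective : ∀ {u v} → affine u ≡ affine v → u ≡ v
  affine-injective refl = refl

  affine-≢ : ∀ {u v} → u ≢ v → affine u ≢ affine v
  affine-≢ u≢v = u≢v ∘ affine-injective

  Affine : PG2 → Set
  Affine p = ∃[ v ] p ≡ affine v

  affine? : Decidable Affine
  affine? (aff x y) = yes ((x , y) , refl)
  affine? (∞₁ x) = no λ ()
  affine? ∞₂ = no λ ()

  ¬affine⇒z≡0 : ∀ {p} → ¬ Affine p → Triple.Z (rep p) ≡ 0#
  ¬affine⇒z≡0 {aff x y} ¬affine = ⊥-elim (¬affine ((x , y) , refl))
  ¬affine⇒z≡0 {∞₁ _} _ = refl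
  ¬affine⇒z≡0 {∞₂} _ = refl

  det-char2 : ∀ x₁ y₁ z₁ x₂ y₂ z₂ x₃ y₃ z₃ →
    det ⟨ x₁ , y₁ , z₁ ⟩ ⟨ x₂ , y₂ , z₂ ⟩ ⟨ x₃ , y₃ , z₃ ⟩ ≡
    x₁ * (y₂ * z₃ + y₃ * z₂) + y₁ * (x₂ * z₃ + x₃ * z₂) + z₁ * (x₂ * y₃ + x₃ * y₂)
  det-char2 x₁ y₁ z₁ x₂ y₂ z₂ x₃ y₃ z₃
    rewrite -x≡x (y₃ * z₂) | -x≡x (x₃ * z₂) | -x≡x (x₃ * y₂)
          | -x≡x (y₁ * (x₂ * z₃ + x₃ * z₂)) = refl

  collinear-at-infinity : ∀ p p′ p″ →
    Triple.Z (rep p) ≡ 0# → Triple.Z (rep p′) ≡ 0# → Triple.Z (rep p″) ≡ 0# → Collinear p p′ p″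
  collinear-at-infinity p p′ p″ z≡0 z′≡0 z″≡0
    with rep p | rep p′ | rep p″
  ... | ⟨ x₁ , y₁ , _ ⟩ | ⟨ x₂ , y₂ , _ ⟩ | ⟨ x₃ , y₃ , _ ⟩ rewrite z≡0 | z′≡0 | z″≡0 = begin
    det ⟨ x₁ , y₁ , 0# ⟩ ⟨ x₂ , y₂ , 0# ⟩ ⟨ x₃ , y₃ , 0# ⟩
      ≡⟨ det-char2 x₁ y₁ 0# x₂ y₂ 0# x₃ y₃ 0# ⟩
    x₁ * (y₂ * 0# + y₃ * 0#) + y₁ * (x₂ * 0# + x₃ * 0#) + 0# * (x₂ * y₃ + x₃ * y₂)
      ≡⟨ solve 6 (λ x₁ y₁ x₂ y₂ x₃ y₃ →
           x₁ :* (y₂ :* con 0 :+ y₃ :* con 0) :+ y₁ :* (x₂ :* con 0 :+ x₃ :* con 0)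
             :+ con 0 :* (x₂ :* y₃ :+ x₃ :* y₂) := con 0) refl x₁ y₁ x₂ y₂ x₃ y₃ ⟩
    0#                                                       ∎

  det-affine : ∀ u v w → det (rep (affine u)) (rep (affine v)) (rep (affine w)) ≡ cross (u ⊕ v) (u ⊕ w)
  det-affine (x₁ , y₁) (x₂ , y₂) (x₃ , y₃) = begin
    det ⟨ x₁ , y₁ , 1# ⟩ ⟨ x₂ , y₂ , 1# ⟩ ⟨ x₃ , y₃ , 1# ⟩
      ≡⟨ det-char2 x₁ y₁ 1# x₂ y₂ 1# x₃ y₃ 1# ⟩
    D                                                       ≡⟨ sym (+-identityʳ D) ⟩
    D + 0#                                                  ≡⟨ cong (D +_) (sym (x+x≡0 (x₁ * y₁))) ⟩
    D + (x₁ * y₁ + x₁ * y₁)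
      ≡⟨ solve 6 (λ x₁ y₁ x₂ y₂ x₃ y₃ →
           x₁ :* (y₂ :* con 1 :+ y₃ :* con 1) :+ y₁ :* (x₂ :* con 1 :+ x₃ :* con 1)
             :+ con 1 :* (x₂ :* y₃ :+ x₃ :* y₂) :+ (x₁ :* y₁ :+ x₁ :* y₁)
           := (x₁ :+ x₂) :* (y₁ :+ y₃) :+ (x₁ :+ x₃) :* (y₁ :+ y₂)) refl x₁ y₁ x₂ y₂ x₃ y₃ ⟩
    (x₁ + x₂) * (y₁ + y₃) + (x₁ + x₃) * (y₁ + y₂)           ∎
    where
    D = x₁ * (y₂ * 1# + y₃ * 1#) + y₁ * (x₂ * 1# + x₃ * 1#) + 1# * (x₂ * y₃ + x₃ * y₂)

  collinear-with-origin : ∀ {u v} → cross u v ≡ 0# → Collinear (affine 𝟘) (affine u) (affine v)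
  collinear-with-origin {u} {v} cross≡0 = begin
    det (rep (affine 𝟘)) (rep (affine u)) (rep (affine v))
                             ≡⟨ det-affine 𝟘 u v ⟩
    cross (𝟘 ⊕ u) (𝟘 ⊕ v)    ≡⟨ cong₂ cross (⊕-identityˡ u) (⊕-identityˡ v) ⟩
    cross u v                ≡⟨ cross≡0 ⟩
    0#                       ∎

  oval-no-three-at-infinity : ∀ {O} → IsOval O → NoThreeDistinct (O ∩ ∁ Affine)
  oval-no-three-at-infinity (_ , no-three-collinear) {p} {p′} {p″}
    p≢p′ p′≢p″ p≢p″ (Op , ∞p) (Op′ , ∞p′) (Op″ , ∞p″) =
    no-three-collinear p p′ p″ Op Op′ Op″ p≢p′ p′≢p″ p≢p″
      (collinear-at-infinity p p′ p″ (¬affine⇒z≡0 ∞p) (¬affine⇒z≡0 ∞p′) (¬affine⇒z≡0 ∞p″))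

  Kernel : PG1 → V → Set
  Kernel t (x , y) = let (α , β) = rep1 t in α * x + β * y ≡ 0#

  kernel-𝟘 : ∀ t → Kernel t 𝟘
  kernel-𝟘 t = solve 2 (λ α β → α :* con 0 :+ β :* con 0 := con 0) refl _ _

  kernel-⊕ : ∀ t {u v} → Kernel t u → Kernel t v → Kernel t (u ⊕ v)
  kernel-⊕ t {x , y} {x′ , y′} αu+βu≡0 αv+βv≡0 = begin
    α * (x + x′) + β * (y + y′)
      ≡⟨ solve 6 (λ α β x y x′ y′ → α :* (x :+ x′) :+ β :* (y :+ y′)
                                    := (α :* x :+ β :* y) :+ (α :* x′ :+ β :* y′)) refl α β x y x′ y′ ⟩
    (α * x + β * y) + (α * x′ + β * y′)  ≡⟨ cong₂ _+_ αu+βu≡0 αv+βv≡0 ⟩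
    0# + 0#                              ≡⟨ +-identityʳ 0# ⟩
    0#                                   ∎
    where
    α = proj₁ (rep1 t)
    β = proj₂ (rep1 t)

  kernel-point : PG1 → Carrier → V
  kernel-point (fin a) k = k , a * k
  kernel-point inf k = 0# , k

  kernel-coordinate : PG1 → V → Carrier
  kernel-coordinate (fin _) (x , _) = x
  kernel-coordinate inf (_ , y) = y

  kernel-point∈kernel : ∀ t k → Kernel t (kernel-point t k)
  kernel-point∈kernel (fin a) k = trans (cong (a * k +_) (*-identityˡ (a * k))) (x+x≡0 (a * k))
  kernel-point∈kernel inf k = solve 1 (λ k → con 1 :* con 0 :+ con 0 :* k := con 0) refl k

  kernel-fin⇒ : ∀ {a x y} → Kernel (fin a) (x , y) → a * x ≡ y
  kernel-fin⇒ {y = y} ax+y≡0 = trans (x+y≡0⇒x≡y ax+y≡0) (*-identityˡ y)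

  kernel-inf⇒x≡0 : ∀ {x y} → Kernel inf (x , y) → x ≡ 0#
  kernel-inf⇒x≡0 {x} {y} x+0y≡0 = trans (sym (1*x+0*y≡x x y)) x+0y≡0

  kernel-point-coordinate : ∀ t {w} → Kernel t w → kernel-point t (kernel-coordinate t w) ≡ w
  kernel-point-coordinate (fin a) {x , y} w∈ = cong (x ,_) (kernel-fin⇒ w∈)
  kernel-point-coordinate inf {x , y} w∈ = cong (_, y) (sym (kernel-inf⇒x≡0 w∈))

  kernel-size : ∀ t → HasSize (Kernel t) q
  kernel-size t =
    size ↔-∘ mk↔ₛ′ (kernel-coordinate t ∘ proj₁) point (λ _ → coordinate-point t) point-coordinate
    where
    point : Carrier → Σ V (Kernel t)
    point k = kernel-point t k , kernel-point∈kernel t k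
    coordinate-point : ∀ t {k} → kernel-coordinate t (kernel-point t k) ≡ k
    coordinate-point (fin _) = refl
    coordinate-point inf = refl
    point-coordinate : ∀ w → point (kernel-coordinate t (proj₁ w)) ≡ w
    point-coordinate (w , w∈) = Σ-≡,≡→≡ (kernel-point-coordinate t w∈ , Decidable⇒UIP.≡-irrelevant _≟_ _ _)

  kernel-subspace : ∀ t → IsNDimF2Subspace (Kernel t)
  kernel-subspace t = kernel-𝟘 t , (λ _ _ → kernel-⊕ t) , kernel-size t

  _≟PG1_ : DecidableEquality PG1
  fin a ≟PG1 fin b with a ≟ b
  ... | yes refl = yes refl
  ... | no a≢b = no λ { refl → a≢b refl }
  fin _ ≟PG1 inf = no λ ()
  inf ≟PG1 fin _ = no λ ()
  inf ≟PG1 inf = yes refl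

  kernel-fin-x≡0⇒𝟘 : ∀ {a x y} → Kernel (fin a) (x , y) → x ≡ 0# → (x , y) ≡ 𝟘
  kernel-fin-x≡0⇒𝟘 {a} {x} {y} w∈ x≡0 = cong₂ _,_ x≡0 (begin
    y        ≡⟨ sym (kernel-fin⇒ w∈) ⟩
    a * x    ≡⟨ cong (a *_) x≡0 ⟩
    a * 0#   ≡⟨ zeroʳ a ⟩
    0#       ∎)

  kernel-trivially-intersecting : ∀ {s t} → s ≢ t → ∀ {w} → Kernel s w → Kernel t w → w ≡ 𝟘
  kernel-trivially-intersecting {fin a} {fin b} a≢b {x , y} w∈s w∈t =
    kernel-fin-x≡0⇒𝟘 w∈s (x≢0∧x*y≡0⇒y≡0 a+b≢0 (begin
      (a + b) * x    ≡⟨ distribʳ x a b ⟩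
      a * x + b * x  ≡⟨ cong₂ _+_ (kernel-fin⇒ w∈s) (kernel-fin⇒ w∈t) ⟩
      y + y          ≡⟨ x+x≡0 y ⟩
      0#             ∎))
    where
    a+b≢0 : a + b ≢ 0#
    a+b≢0 a+b≡0 = a≢b (cong fin (x+y≡0⇒x≡y a+b≡0))
  kernel-trivially-intersecting {fin a} {inf} _ {x , y} w∈s w∈t = kernel-fin-x≡0⇒𝟘 w∈s (kernel-inf⇒x≡0 w∈t)
  kernel-trivially-intersecting {inf} {fin a} inf≢fin w∈s w∈t =
    kernel-trivially-intersecting {fin a} {inf} (inf≢fin ∘ sym) w∈t w∈s
  kernel-trivially-intersecting {inf} {inf} inf≢inf = ⊥-elim (inf≢inf refl)

  kernel-cover : ∀ w → ∃[ t ] Kernel t w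
  kernel-cover (x , y) with x ≟ 0#
  ... | yes x≡0 = inf , trans (1*x+0*y≡x x y) x≡0
  ... | no x≢0 = fin (y * x⁻¹) , (begin
    (y * x⁻¹) * x + 1# * y
      ≡⟨ solve 3 (λ x x⁻¹ y → (y :* x⁻¹) :* x :+ con 1 :* y := y :* (x :* x⁻¹) :+ y) refl x x⁻¹ y ⟩
    y * (x * x⁻¹) + y        ≡⟨ cong (λ e → y * e + y) (*-inverseʳ x x≢0) ⟩
    y * 1# + y               ≡⟨ cong (_+ y) (*-identityʳ y) ⟩
    y + y                    ≡⟨ x+x≡0 y ⟩
    0#                       ∎)
    where x⁻¹ = inv x x≢0

  kernel-spread : IsSpread Kernel
  kernel-spread = kernel-subspace , (λ _ _ s≢t _ → kernel-trivially-intersecting s≢t) , kernel-cover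

  kernel-inf≐line-spread-0 : ∀ w → Kernel inf w ⇔ LineSpread (fin 0#) w
  kernel-inf≐line-spread-0 (x , y) = mk⇔
    (λ x+0y≡0 → y , trans (kernel-inf⇒x≡0 x+0y≡0) (sym (zeroʳ y)) , sym (*-identityʳ y))
    (λ { (k , x≡k0 , _) → trans (1*x+0*y≡x x y) (trans x≡k0 (zeroʳ k)) })

  kernel-0≐line-spread-inf : ∀ w → Kernel (fin 0#) w ⇔ LineSpread inf w
  kernel-0≐line-spread-inf (x , y) = mk⇔
    (λ 0x+y≡0 → x , sym (*-identityʳ x) , trans (trans (sym (0*x+1*y≡y x y)) 0x+y≡0) (sym (zeroʳ x)))
    (λ { (k , _ , y≡k0) → trans (0*x+1*y≡y x y) (trans y≡k0 (zeroʳ k)) })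

  kernel≐line-spread-inverse : ∀ {c d} → c * d ≡ 1# → ∀ w → Kernel (fin c) w ⇔ LineSpread (fin d) w
  kernel≐line-spread-inverse {c} {d} cd≡1 (x , y) = mk⇔ to from
    where
    to : c * x + 1# * y ≡ 0# → ∃[ k ] (x ≡ k * d × y ≡ k * 1#)
    to cx+y≡0 = y , (begin
      x              ≡⟨ sym (*-identityʳ x) ⟩
      x * 1#         ≡⟨ cong (x *_) (sym cd≡1) ⟩
      x * (c * d)    ≡⟨ solve 3 (λ c d x → x :* (c :* d) := (c :* x) :* d) refl c d x ⟩
      (c * x) * d    ≡⟨ cong (_* d) (trans (x+y≡0⇒x≡y cx+y≡0) (*-identityˡ y)) ⟩
      y * d          ∎) , sym (*-identityʳ y)
    from : ∃[ k ] (x ≡ k * d × y ≡ k * 1#) → c * x + 1# * y ≡ 0#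
    from (k , x≡kd , y≡k1) = begin
      c * x + 1# * y         ≡⟨ cong₂ (λ x y → c * x + 1# * y) x≡kd (trans y≡k1 (*-identityʳ k)) ⟩
      c * (k * d) + 1# * k   ≡⟨ solve 3 (λ c d k → c :* (k :* d) :+ con 1 :* k := k :* (c :* d) :+ k) refl c d k ⟩
      k * (c * d) + k        ≡⟨ cong (λ e → k * e + k) cd≡1 ⟩
      k * 1# + k             ≡⟨ cong (_+ k) (*-identityʳ k) ⟩
      k + k                  ≡⟨ x+x≡0 k ⟩
      0#                     ∎

  kernel≐line-spread : ∀ t → ∃[ s ] (∀ w → Kernel t w ⇔ LineSpread s w)
  kernel≐line-spread inf = fin 0# , kernel-inf≐line-spread-0
  kernel≐line-spread (fin c) with c ≟ 0#
  ... | yes refl = inf , kernel-0≐line-spread-inf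
  ... | no c≢0 = fin (inv c c≢0) , kernel≐line-spread-inverse (*-inverseʳ c c≢0)

  line-spread≐kernel : ∀ s → ∃[ t ] (∀ w → Kernel t w ⇔ LineSpread s w)
  line-spread≐kernel inf = fin 0# , kernel-0≐line-spread-inf
  line-spread≐kernel (fin d) with d ≟ 0#
  ... | yes refl = inf , kernel-inf≐line-spread-0
  ... | no d≢0 = fin (inv d d≢0) , kernel≐line-spread-inverse (trans (*-comm _ d) (*-inverseʳ d d≢0))

  module _ (f : V ↔ V) (f-⊕ : ∀ u v → Inverse.to f (u ⊕ v) ≡ Inverse.to f u ⊕ Inverse.to f v) where
    open Inverse f

    additive⇒𝟘 : to 𝟘 ≡ 𝟘
    additive⇒𝟘 = begin
      to 𝟘                            ≡⟨ sym (⊕-identityˡ (to 𝟘)) ⟩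
      𝟘 ⊕ to 𝟘                        ≡⟨ cong (_⊕ to 𝟘) (sym (⊕-self (to 𝟘))) ⟩
      (to 𝟘 ⊕ to 𝟘) ⊕ to 𝟘            ≡⟨ cong (_⊕ to 𝟘) (sym (f-⊕ 𝟘 𝟘)) ⟩
      to (𝟘 ⊕ 𝟘) ⊕ to 𝟘               ≡⟨ cong (λ u → to u ⊕ to 𝟘) (⊕-self 𝟘) ⟩
      to 𝟘 ⊕ to 𝟘                     ≡⟨ ⊕-self (to 𝟘) ⟩
      𝟘                               ∎

    additive⇒⊖ : ∀ u v → to (u ⊖ v) ≡ to u ⊖ to v
    additive⇒⊖ u v = trans (cong to (⊖≡⊕ u v)) (trans (f-⊕ u v) (sym (⊖≡⊕ (to u) (to v))))

    preimage-subspace : ∀ {W} → IsNDimF2Subspace W → IsNDimF2Subspace (W ∘ to)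
    preimage-subspace {W} (W𝟘 , W⊕ , W-size) =
      subst W (sym additive⇒𝟘) W𝟘 ,
      (λ u v Wu Wv → subst W (sym (f-⊕ u v)) (W⊕ _ _ Wu Wv)) ,
      W-size ↔-∘ Σ-↔ f (↔-id _)

    preimage-spread : ∀ {I} {W : I → V → Set} → IsSpread W → IsSpread (λ i → W i ∘ to)
    preimage-spread {W = W} (subspaces , trivially-intersecting , cover) =
      (λ i → preimage-subspace (subspaces i)) ,
      (λ i j i≢j v v∈i v∈j → inverseʳ⇒injective to inverseʳ
        (trans (trivially-intersecting i j i≢j (to v) v∈i v∈j) (sym additive⇒𝟘))) ,
      (λ v → cover (to v))

    isomorphic-via : ∀ {I J} {W : I → V → Set} {W′ : J → V → Set} →
      (∀ i → ∃[ j ] (∀ w → W i w ⇔ W′ j w)) → (∀ j → ∃[ i ] (∀ w → W i w ⇔ W′ j w)) →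
      IsomorphicPlanes (λ i v → W i (to v)) W′
    isomorphic-via {W = W} {W′} W⇒W′ W′⇒W = f , image , preimage
      where
      image : ∀ L → IsLine (λ i v → W i (to v)) L → IsLine W′ (L ∘ from)
      image L (i , v , L≐) = j , to v , λ w →
        Wi≐W′j (w ⊖ to v) ⇔-∘ (≡⇒⇔ (W i) (translate w) ⇔-∘ L≐ (from w))
        where
        j = proj₁ (W⇒W′ i)
        Wi≐W′j = proj₂ (W⇒W′ i)
        translate : ∀ w → to (from w ⊖ v) ≡ w ⊖ to v
        translate w = trans (additive⇒⊖ (from w) v) (cong (_⊖ to v) (strictlyInverseˡ w))
      preimage : ∀ L → IsLine W′ L → IsLine (λ i v → W i (to v)) (L ∘ to)
      preimage L (j , v , L≐) = i , from v , λ w →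
        ⇔-sym (Wi≐W′j (to (w ⊖ from v))) ⇔-∘ (≡⇒⇔ (W′ j) (sym (translate w)) ⇔-∘ L≐ (to w))
        where
        i = proj₁ (W′⇒W j)
        Wi≐W′j = proj₂ (W′⇒W j)
        translate : ∀ w → to (w ⊖ from v) ≡ to w ⊖ v
        translate w = trans (additive⇒⊖ w (from v)) (cong (to w ⊖_) (strictlyInverseˡ v))

  NoThreeCollinear : (V → Set) → Set
  NoThreeCollinear X = ∀ {u v w} → u ≢ v → v ≢ w → u ≢ w → X u → X v → X w →
    ¬ Collinear (affine u) (affine v) (affine w)

  line-spread⇒multiple : ∀ s {w} → LineSpread s w → ∃[ k ] w ≡ k · rep1 s
  line-spread⇒multiple s (k , x≡kα , y≡kβ) = k , cong₂ _,_ x≡kα y≡kβ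

  line-spread-collinear : ∀ s m p {u v w} →
    LineSpread s (u ⊖ m) → LineSpread s (v ⊖ m) → LineSpread s (w ⊖ m) →
    Collinear (affine (u ⊖ p)) (affine (v ⊖ p)) (affine (w ⊖ p))
  line-spread-collinear s m p {u} {v} {w} u∈ v∈ w∈
    with line-spread⇒multiple s u∈ | line-spread⇒multiple s v∈ | line-spread⇒multiple s w∈
  ... | k₁ , u≡ | k₂ , v≡ | k₃ , w≡ = begin
    det (rep (affine (u ⊖ p))) (rep (affine (v ⊖ p))) (rep (affine (w ⊖ p)))
      ≡⟨ det-affine (u ⊖ p) (v ⊖ p) (w ⊖ p) ⟩
    cross ((u ⊖ p) ⊕ (v ⊖ p)) ((u ⊖ p) ⊕ (w ⊖ p))
      ≡⟨ cong₂ cross (rebase v) (rebase w) ⟩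
    cross ((u ⊖ m) ⊕ (v ⊖ m)) ((u ⊖ m) ⊕ (w ⊖ m))
      ≡⟨ cong₂ cross (cong₂ _⊕_ u≡ v≡) (cong₂ _⊕_ u≡ w≡) ⟩
    cross ((k₁ · d) ⊕ (k₂ · d)) ((k₁ · d) ⊕ (k₃ · d))
      ≡⟨ cong₂ cross (·-distribʳ k₁ k₂ d) (·-distribʳ k₁ k₃ d) ⟩
    cross ((k₁ + k₂) · d) ((k₁ + k₃) · d)
      ≡⟨ cross-· (k₁ + k₂) (k₁ + k₃) d ⟩
    0#  ∎
    where
    d = rep1 s
    rebase : ∀ z → (u ⊖ p) ⊕ (z ⊖ p) ≡ (u ⊖ m) ⊕ (z ⊖ m)
    rebase z = trans (⊖-⊕-⊖ u z p) (sym (⊖-⊕-⊖ u z m))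

  orthogoval-line-spread : ∀ {I} (W : I → V → Set) → (∀ i → NoThreeCollinear (W i)) → Orthogoval W LineSpread
  orthogoval-line-spread W arcs L M (i , p , L≐) (s , m , M≐) u v w Lu Lv Lw Mu Mv Mw
    with u ≟V v | v ≟V w | u ≟V w
  ... | yes u≡v | _ | _ = inj₁ u≡v
  ... | no _ | yes v≡w | _ = inj₂ (inj₁ v≡w)
  ... | no _ | no _ | yes u≡w = inj₂ (inj₂ u≡w)
  ... | no u≢v | no v≢w | no u≢w = ⊥-elim (arcs i (shift u≢v) (shift v≢w) (shift u≢w)
          (on-L Lu) (on-L Lv) (on-L Lw) (line-spread-collinear s m p (on-M Mu) (on-M Mv) (on-M Mw)))
    where
    shift : ∀ {a b} → a ≢ b → a ⊖ p ≢ b ⊖ p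
    shift a≢b e = a≢b (⊖-cancelʳ p e)
    on-L : ∀ {a} → L a → W i (a ⊖ p)
    on-L = Equivalence.to (L≐ _)
    on-M : ∀ {a} → M a → LineSpread s (a ⊖ m)
    on-M = Equivalence.to (M≐ _)

module Conics {n : ℕ} (F : GF2^ n) where
  open GF2^ F
  open Char2Field F
  open Geometry F
  open PlaneGeometry F
  open ≡-Reasoning

  evalAff : QForm → V → Carrier
  evalAff Q (x , y) = eval Q x y 1#

  eval-lin : ∀ α Q β R x y z → eval (lin α Q β R) x y z ≡ α * eval Q x y z + β * eval R x y z
  eval-lin α Q β R x y z = solve 17 (λ α β a b c d e f a′ b′ c′ d′ e′ f′ x y z →
      (α :* a :+ β :* a′) :* (x :* x) :+ (α :* b :+ β :* b′) :* (y :* y) :+ (α :* c :+ β :* c′) :* (z :* z)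
        :+ (α :* d :+ β :* d′) :* (x :* y) :+ (α :* e :+ β :* e′) :* (x :* z) :+ (α :* f :+ β :* f′) :* (y :* z)
      := α :* (a :* (x :* x) :+ b :* (y :* y) :+ c :* (z :* z) :+ d :* (x :* y) :+ e :* (x :* z) :+ f :* (y :* z))
        :+ β :* (a′ :* (x :* x) :+ b′ :* (y :* y) :+ c′ :* (z :* z) :+ d′ :* (x :* y) :+ e′ :* (x :* z) :+ f′ :* (y :* z)))
    refl α β a b c d e f a′ b′ c′ d′ e′ f′ x y z
    where
    open QForm Q
    open QForm R renaming (a to a′; b to b′; c to c′; d to d′; e to e′; f to f′)

  module _ (Q : QForm) where
    open QForm Q

    evalAff-𝟘 : evalAff Q 𝟘 ≡ c
    evalAff-𝟘 = solve 6 (λ a b c d e f →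
        a :* (con 0 :* con 0) :+ b :* (con 0 :* con 0) :+ c :* (con 1 :* con 1)
          :+ d :* (con 0 :* con 0) :+ e :* (con 0 :* con 1) :+ f :* (con 0 :* con 1) := c)
      refl a b c d e f

    eval-∞₁ : ∀ x → eval Q x 1# 0# ≡ a * (x * x) + d * x + b
    eval-∞₁ x = solve 7 (λ a b c d e f x →
        a :* (x :* x) :+ b :* (con 1 :* con 1) :+ c :* (con 0 :* con 0) :+ d :* (x :* con 1)
          :+ e :* (x :* con 0) :+ f :* (con 1 :* con 0) := a :* (x :* x) :+ d :* x :+ b)
      refl a b c d e f x

    eval-∞₂ : eval Q 1# 0# 0# ≡ a
    eval-∞₂ = solve 6 (λ a b c d e f →
        a :* (con 1 :* con 1) :+ b :* (con 0 :* con 0) :+ c :* (con 0 :* con 0)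
          :+ d :* (con 1 :* con 0) :+ e :* (con 1 :* con 0) :+ f :* (con 0 :* con 0) := a)
      refl a b c d e f

    evalAff-⊕ : c ≡ 0# → ∀ u v → evalAff Q (u ⊕ v) ≡ evalAff Q u + evalAff Q v + d * cross u v
    evalAff-⊕ c≡0 u@(x , y) v@(x′ , y′) = begin
      evalAff Q (u ⊕ v)                                    ≡⟨ sym (+-identityʳ _) ⟩
      evalAff Q (u ⊕ v) + 0#                               ≡⟨ cong (evalAff Q (u ⊕ v) +_) (sym c1≡0) ⟩
      evalAff Q (u ⊕ v) + c * (1# * 1#)
        ≡⟨ solve 10 (λ a b c d e f x y x′ y′ →
             a :* ((x :+ x′) :* (x :+ x′)) :+ b :* ((y :+ y′) :* (y :+ y′)) :+ c :* (con 1 :* con 1)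
               :+ d :* ((x :+ x′) :* (y :+ y′)) :+ e :* ((x :+ x′) :* con 1) :+ f :* ((y :+ y′) :* con 1)
               :+ c :* (con 1 :* con 1)
             := (a :* (x :* x) :+ b :* (y :* y) :+ c :* (con 1 :* con 1) :+ d :* (x :* y) :+ e :* (x :* con 1) :+ f :* (y :* con 1))
               :+ (a :* (x′ :* x′) :+ b :* (y′ :* y′) :+ c :* (con 1 :* con 1) :+ d :* (x′ :* y′) :+ e :* (x′ :* con 1) :+ f :* (y′ :* con 1))
               :+ d :* (x :* y′ :+ x′ :* y) :+ (a :* (x :* x′) :+ a :* (x :* x′)) :+ (b :* (y :* y′) :+ b :* (y :* y′)))
           refl a b c d e f x y x′ y′ ⟩
      evalAff Q u + evalAff Q v + d * cross u v + (a * (x * x′) + a * (x * x′)) + (b * (y * y′) + b * (y * y′))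
        ≡⟨ cong₂ (λ r s → evalAff Q u + evalAff Q v + d * cross u v + r + s) (x+x≡0 _) (x+x≡0 _) ⟩
      evalAff Q u + evalAff Q v + d * cross u v + 0# + 0#
        ≡⟨ cong (_+ 0#) (+-identityʳ _) ⟩
      evalAff Q u + evalAff Q v + d * cross u v + 0#
        ≡⟨ +-identityʳ _ ⟩
      evalAff Q u + evalAff Q v + d * cross u v             ∎
      where
      c1≡0 : c * (1# * 1#) ≡ 0#
      c1≡0 = trans (cong (_* (1# * 1#)) c≡0) (zeroˡ _)

    evalAff-additive : c ≡ 0# → d ≡ 0# → ∀ u v → evalAff Q (u ⊕ v) ≡ evalAff Q u + evalAff Q v
    evalAff-additive c≡0 d≡0 u v = begin
      evalAff Q (u ⊕ v)                            ≡⟨ evalAff-⊕ c≡0 u v ⟩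
      evalAff Q u + evalAff Q v + d * cross u v    ≡⟨ cong (λ d → evalAff Q u + evalAff Q v + d * cross u v) d≡0 ⟩
      evalAff Q u + evalAff Q v + 0# * cross u v   ≡⟨ cong (evalAff Q u + evalAff Q v +_) (zeroˡ _) ⟩
      evalAff Q u + evalAff Q v + 0#               ≡⟨ +-identityʳ _ ⟩
      evalAff Q u + evalAff Q v                    ∎

  module ConicTranslationOval (Q : QForm) (Q-oval : IsTranslationOval (ConicPts Q)) (3≤size : 3 ≤ suc q) where
    open QForm Q

    O : PG2 → Set
    O = ConicPts Q

    oval : IsOval O
    oval = proj₁ Q-oval

    no-three-collinear : ∀ p p′ p″ → O p → O p′ → O p″ →
      p ≢ p′ → p′ ≢ p″ → p ≢ p″ → ¬ Collinear p p′ p″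
    no-three-collinear = proj₂ oval

    O-irrelevant : ∀ {p} (o o′ : O p) → o ≡ o′
    O-irrelevant = Decidable⇒UIP.≡-irrelevant _≟_

    elements : Σ[ xs ∈ List PG2 ] Unique xs × All O xs × length xs ≡ suc q
    elements = enumeration (proj₁ oval) (λ {p} → O-irrelevant {p})

    has-affine-point : ∃[ v ] O (affine v)
    has-affine-point with elements
    ... | xs , xs! , Oxs , len≡ with some-element affine? (oval-no-three-at-infinity oval) xs! Oxs
                                         (subst (3 ≤_) (sym len≡) 3≤size)
    ...   | _ , Op , v , refl = v , Op

    origin∈O : O (affine 𝟘)
    origin∈O with has-affine-point
    ... | v@(x , y) , Ov = subst (O ∘ affine) (⊕-self v) (proj₂ Q-oval x y x y Ov Ov)

    c≡0 : c ≡ 0#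
    c≡0 = trans (sym (evalAff-𝟘 Q)) origin∈O

    module _ (d≢0 : d ≢ 0#) where

      cross≡0 : ∀ {u v} → O (affine u) → O (affine v) → cross u v ≡ 0#
      cross≡0 {u} {v} Ou Ov = x≢0∧x*y≡0⇒y≡0 d≢0 (begin
        d * cross u v                                 ≡⟨ sym (+-identityˡ _) ⟩
        0# + d * cross u v                            ≡⟨ cong (λ e → e + d * cross u v) (sym (+-identityʳ 0#)) ⟩
        0# + 0# + d * cross u v                       ≡⟨ cong₂ (λ r s → r + s + d * cross u v) (sym Ou) (sym Ov) ⟩
        evalAff Q u + evalAff Q v + d * cross u v     ≡⟨ sym (evalAff-⊕ Q c≡0 u v) ⟩
        evalAff Q (u ⊕ v)                             ≡⟨ proj₂ Q-oval _ _ _ _ Ou Ov ⟩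
        0#                                            ∎)

      no-two-nonzero-affine : ∀ {u v} → u ≢ 𝟘 → v ≢ 𝟘 → u ≢ v → O (affine u) → O (affine v) → ⊥
      no-two-nonzero-affine u≢𝟘 v≢𝟘 u≢v Ou Ov =
        no-three-collinear _ _ _ origin∈O Ou Ov
          (affine-≢ (u≢𝟘 ∘ sym)) (affine-≢ u≢v) (affine-≢ (v≢𝟘 ∘ sym))
          (collinear-with-origin (cross≡0 Ou Ov))

      no-three-affine : NoThreeDistinct (O ∩ Affine)
      no-three-affine p≢p′ p′≢p″ p≢p″ (Op , u , refl) (Op′ , v , refl) (Op″ , w , refl)
        with u ≟V 𝟘 | v ≟V 𝟘
      ... | yes refl | _ =
        no-two-nonzero-affine (p≢p′ ∘ cong affine ∘ sym) (p≢p″ ∘ cong affine ∘ sym) (p′≢p″ ∘ cong affine) Op′ Op″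
      ... | no u≢𝟘 | yes refl =
        no-two-nonzero-affine u≢𝟘 (p′≢p″ ∘ cong affine ∘ sym) (p≢p″ ∘ cong affine) Op Op″
      ... | no u≢𝟘 | no v≢𝟘 = no-two-nonzero-affine u≢𝟘 v≢𝟘 (p≢p′ ∘ cong affine) Op Op′

      size≤4 : suc q ≤ 4
      size≤4 with elements
      ... | _ , xs! , Oxs , len≡ =
        subst (_≤ 4) len≡ (unique-length≤4 affine? no-three-affine (oval-no-three-at-infinity oval) xs! Oxs)

      -- The points at infinity are the roots of a x² + d x y + b y², which come in pairs as d ≠ 0.
      other-point-at-infinity : ∀ {p} → O p → ¬ Affine p → ∃[ p′ ] (O p′ × ¬ Affine p′ × p′ ≢ p)
      other-point-at-infinity {aff x y} _ ¬affine = ⊥-elim (¬affine ((x , y) , refl))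
      other-point-at-infinity {∞₂} O∞₂ _ = ∞₁ (b * inv d d≢0) , root , (λ { (_ , ()) }) , λ ()
        where
        a≡0 : a ≡ 0#
        a≡0 = trans (sym (eval-∞₂ Q)) O∞₂
        root : eval Q (b * inv d d≢0) 1# 0# ≡ 0#
        root = begin
          eval Q t 1# 0#                     ≡⟨ eval-∞₁ Q t ⟩
          a * (t * t) + d * t + b            ≡⟨ cong (λ a → a * (t * t) + d * t + b) a≡0 ⟩
          0# * (t * t) + d * (b * d⁻¹) + b   ≡⟨ solve 4 (λ b d d⁻¹ t →
              con 0 :* (t :* t) :+ d :* (b :* d⁻¹) :+ b := b :* (d :* d⁻¹) :+ b) refl b d d⁻¹ t ⟩
          b * (d * d⁻¹) + b                  ≡⟨ cong (λ e → b * e + b) (*-inverseʳ d d≢0) ⟩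
          b * 1# + b                         ≡⟨ cong (_+ b) (*-identityʳ b) ⟩
          b + b                              ≡⟨ x+x≡0 b ⟩
          0#                                 ∎
          where
          d⁻¹ = inv d d≢0
          t = b * d⁻¹
      other-point-at-infinity {∞₁ t} O∞₁ _ with a ≟ 0#
      ... | yes a≡0 = ∞₂ , trans (eval-∞₂ Q) a≡0 , (λ { (_ , ()) }) , λ ()
      ... | no a≢0 = ∞₁ (t + δ) , root , (λ { (_ , ()) }) , shifted
        where
        a⁻¹ = inv a a≢0
        δ = d * a⁻¹
        root : eval Q (t + δ) 1# 0# ≡ 0#
        root = trans (eval-∞₁ Q (t + δ)) (quadratic-other-root a≢0 (trans (sym (eval-∞₁ Q t)) O∞₁))
        δ≢0 : δ ≢ 0#
        δ≢0 δ≡0 = d≢0 (begin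
          d                    ≡⟨ sym (*-identityʳ d) ⟩
          d * 1#               ≡⟨ cong (d *_) (sym (*-inverseʳ a a≢0)) ⟩
          d * (a * a⁻¹)        ≡⟨ solve 3 (λ a d a⁻¹ → d :* (a :* a⁻¹) := a :* (d :* a⁻¹)) refl a d a⁻¹ ⟩
          a * δ                ≡⟨ cong (a *_) δ≡0 ⟩
          a * 0#               ≡⟨ zeroʳ a ⟩
          0#                   ∎)
        shifted : ∞₁ (t + δ) ≢ ∞₁ t
        shifted e = δ≢0 (begin
          δ                    ≡⟨ sym (+-identityʳ δ) ⟩
          δ + 0#               ≡⟨ cong (δ +_) (sym (x+x≡0 t)) ⟩
          δ + (t + t)          ≡⟨ solve 2 (λ t δ → δ :+ (t :+ t) := (t :+ δ) :+ t) refl t δ ⟩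
          (t + δ) + t          ≡⟨ cong (_+ t) (∞₁-injective e) ⟩
          t + t                ≡⟨ x+x≡0 t ⟩
          0#                   ∎)
          where
          ∞₁-injective : ∀ {x y} → ∞₁ x ≡ ∞₁ y → x ≡ y
          ∞₁-injective refl = refl

      no-three-¬¬affine : NoThreeDistinct (O ∩ ∁ (∁ Affine))
      no-three-¬¬affine p≢p′ p′≢p″ p≢p″ (Op , ¬¬a) (Op′ , ¬¬a′) (Op″ , ¬¬a″) =
        no-three-affine p≢p′ p′≢p″ p≢p″ (Op , stable ¬¬a) (Op′ , stable ¬¬a′) (Op″ , stable ¬¬a″)
        where
        stable : ∀ {p} → ¬ ¬ Affine p → Affine p
        stable = decidable-stable (affine? _)

      no-nonzero-affine : suc q ≤ 3 → ∀ {u} → u ≢ 𝟘 → ¬ O (affine u)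
      no-nonzero-affine size≤3 {u} u≢𝟘 Ou with elements
      ... | xs , xs! , Oxs , len≡
        with some-element (∁? affine?) no-three-¬¬affine xs! Oxs (subst (3 ≤_) (sym len≡) 3≤size)
      ... | p , Op , p∞ with other-point-at-infinity Op p∞
      ... | p′ , Op′ , p′∞ , p′≢p =
        <⇒≱ (unique-length≤size (proj₁ oval) four-distinct (origin∈O ∷ Ou ∷ Op ∷ Op′ ∷ [])) size≤3
        where
        affine≢ : ∀ {v p} → ¬ Affine p → affine v ≢ p
        affine≢ {v} p∞ e = p∞ (v , sym e)
        four-distinct : Unique (affine 𝟘 ∷ affine u ∷ p ∷ p′ ∷ [])
        four-distinct =
          (affine-≢ (u≢𝟘 ∘ sym) ∷ affine≢ p∞ ∷ affine≢ p′∞ ∷ []) ∷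
          (affine≢ p∞ ∷ affine≢ p′∞ ∷ []) ∷
          ((p′≢p ∘ sym) ∷ []) ∷ [] ∷ []

power-of-two-cases : ∀ n → 1 ≤ n → suc (2 ℕ.^ n) ≤ 3 ⊎ 4 ≤ 2 ℕ.^ n
power-of-two-cases 1 _ = inj₁ ℕP.≤-refl
power-of-two-cases (suc (suc k)) _ = inj₂ (ℕP.^-monoʳ-≤ 2 {2} {suc (suc k)} (s≤s (s≤s z≤n)))

module Pencil {n : ℕ} (F : GF2^ n) (φ χ : Geometry.QForm F)
  (pencil : Geometry.TIPencilOfConicTranslationOvals F φ χ) (1≤n : 1 ≤ n) where
  open GF2^ F
  open Char2Field F
  open Geometry F
  open PlaneGeometry F
  open Conics F

  2≤q : 2 ≤ q
  2≤q = ℕP.^-monoʳ-≤ 2 1≤n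

  module Member (t : PG1) = ConicTranslationOval (member φ χ t) (proj₂ (proj₁ pencil t)) (s≤s 2≤q)

  S⇒member : ∀ t {v} → S φ χ t v → ConicPts (member φ χ t) (affine v)
  S⇒member t {x , y} = trans (eval-lin (proj₁ (rep1 t)) φ (proj₂ (rep1 t)) χ x y 1#)

  -- Kernel t (coefficients QForm.c) is definitionally the statement that member t has c = 0.
  coefficients : (QForm → Carrier) → V
  coefficients k = k φ , k χ

  c≡𝟘 : coefficients QForm.c ≡ 𝟘
  c≡𝟘 = kernel-trivially-intersecting {inf} {fin 0#} (λ ()) (Member.c≡0 inf) (Member.c≡0 (fin 0#))

  -- S φ χ t v is definitionally Kernel t (Ψ v).
  Ψ : V → V
  Ψ v = evalAff φ v , evalAff χ v

  S-cover : ∀ v → ∃[ t ] S φ χ t v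
  S-cover v = kernel-cover (Ψ v)

  S-trivially-intersecting : ∀ {s t} → s ≢ t → ∀ {v} → S φ χ s v → S φ χ t v → v ≡ 𝟘
  S-trivially-intersecting {s} {t} s≢t {v} v∈s v∈t =
    affine-injective (proj₂ pencil s t s≢t (affine v) (S⇒member s v∈s) (S⇒member t v∈t))

  member-d≡0 : 4 ≤ q → ∀ t → QForm.d (member φ χ t) ≡ 0#
  member-d≡0 4≤q t with QForm.d (member φ χ t) ≟ 0#
  ... | yes d≡0 = d≡0
  ... | no d≢0 = ⊥-elim (<⇒≱ (s≤s 4≤q) (Member.size≤4 t d≢0))

  nonzero-member-d≡0 : suc q ≤ 3 → ∀ t {v} → v ≢ 𝟘 → S φ χ t v → QForm.d (member φ χ t) ≡ 0#
  nonzero-member-d≡0 size≤3 t v≢𝟘 v∈t with QForm.d (member φ χ t) ≟ 0#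
  ... | yes d≡0 = d≡0
  ... | no d≢0 = ⊥-elim (Member.no-nonzero-affine t d≢0 size≤3 v≢𝟘 (S⇒member t v∈t))

  -- The members through (1,0), (0,1) and (1,1) have d = 0; if two of them differ, d_φ = d_χ = 0,
  -- and otherwise one oval of size 3 contains four points.
  d≡𝟘-small : suc q ≤ 3 → coefficients QForm.d ≡ 𝟘
  d≡𝟘-small size≤3 with S-cover (1# , 0#) | S-cover (0# , 1#) | S-cover (1# , 1#)
  ... | s , e₁∈s | t , e₂∈t | r , e₁₂∈r with s ≟PG1 t | s ≟PG1 r
  ... | no s≢t | _ = kernel-trivially-intersecting s≢t
    (nonzero-member-d≡0 size≤3 s (differ-in-x 1≢0) e₁∈s)
    (nonzero-member-d≡0 size≤3 t (differ-in-y 1≢0) e₂∈t)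
  ... | yes refl | no s≢r = kernel-trivially-intersecting s≢r
    (nonzero-member-d≡0 size≤3 s (differ-in-x 1≢0) e₁∈s)
    (nonzero-member-d≡0 size≤3 r (differ-in-x 1≢0) e₁₂∈r)
  ... | yes refl | yes refl = ⊥-elim (<⇒≱ (unique-length≤size (proj₁ (Member.oval s)) four-distinct
      (Member.origin∈O s ∷ S⇒member s e₁∈s ∷ S⇒member s e₂∈t ∷ S⇒member s e₁₂∈r ∷ [])) size≤3)
    where
    four-distinct : Unique (affine 𝟘 ∷ affine (1# , 0#) ∷ affine (0# , 1#) ∷ affine (1# , 1#) ∷ [])
    four-distinct =
      (affine-≢ (differ-in-x 0≢1) ∷ affine-≢ (differ-in-y 0≢1) ∷ affine-≢ (differ-in-x 0≢1) ∷ []) ∷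
      (affine-≢ (differ-in-x 1≢0) ∷ affine-≢ (differ-in-y 0≢1) ∷ []) ∷
      (affine-≢ (differ-in-x 0≢1) ∷ []) ∷ [] ∷ []

  d≡𝟘 : coefficients QForm.d ≡ 𝟘
  d≡𝟘 with power-of-two-cases n 1≤n
  ... | inj₁ size≤3 = d≡𝟘-small size≤3
  ... | inj₂ 4≤q = kernel-trivially-intersecting {inf} {fin 0#} (λ ())
                     (member-d≡0 4≤q inf) (member-d≡0 4≤q (fin 0#))

  Ψ-⊕ : ∀ u v → Ψ (u ⊕ v) ≡ Ψ u ⊕ Ψ v
  Ψ-⊕ u v = cong₂ _,_
    (evalAff-additive φ (cong proj₁ c≡𝟘) (cong proj₁ d≡𝟘) u v)
    (evalAff-additive χ (cong proj₂ c≡𝟘) (cong proj₂ d≡𝟘) u v)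

  Ψ-injective : ∀ {u v} → Ψ u ≡ Ψ v → u ≡ v
  Ψ-injective {u} {v} Ψu≡Ψv = ⊕≡𝟘⇒≡ (S-trivially-intersecting {inf} {fin 0#} (λ ()) (in-S inf) (in-S (fin 0#)))
    where
    Ψ[u⊕v]≡𝟘 : Ψ (u ⊕ v) ≡ 𝟘
    Ψ[u⊕v]≡𝟘 = trans (Ψ-⊕ u v) (trans (cong (_⊕ Ψ v) Ψu≡Ψv) (⊕-self (Ψ v)))
    in-S : ∀ t → S φ χ t (u ⊕ v)
    in-S t = subst (Kernel t) (sym Ψ[u⊕v]≡𝟘) (kernel-𝟘 t)

  Ψ↔ : V ↔ V
  Ψ↔ = injective-endo↔ (↔-sym *↔× ↔-∘ (size ×-↔ size)) Ψ Ψ-injective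

  spread : IsSpread (S φ χ)
  spread = preimage-spread Ψ↔ Ψ-⊕ kernel-spread

  desarguesian : IsDesarguesian (S φ χ)
  desarguesian = isomorphic-via Ψ↔ Ψ-⊕ kernel≐line-spread line-spread≐kernel

  orthogoval : Orthogoval (S φ χ) LineSpread
  orthogoval = orthogoval-line-spread (S φ χ) λ t u≢v v≢w u≢w u∈ v∈ w∈ →
    Member.no-three-collinear t _ _ _ (S⇒member t u∈) (S⇒member t v∈) (S⇒member t w∈)
      (affine-≢ u≢v) (affine-≢ v≢w) (affine-≢ u≢w)

theorem3p8 : (n : ℕ) → 1 ≤ n → (F : GF2^ n) → (φ χ : Geometry.QForm F) →
    Geometry.TIPencilOfConicTranslationOvals F φ χ →
    Geometry.IsSpread F (Geometry.S F φ χ)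
    × Geometry.IsDesarguesian F (Geometry.S F φ χ)
    × Geometry.Orthogoval F (Geometry.S F φ χ) (Geometry.LineSpread F)
theorem3p8 n 1≤n F φ χ pencil = spread , desarguesian , orthogoval
  where open Pencil F φ χ pencil 1≤n
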